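{- For every connected graph $G$, $|V(G)|\le \pi(G)\le \eta(G)$.
   Context: All graphs are finite, simple and connected. A configuration $C$ on $G$ is a function $C:V(G)\to\mathbb{Z}_{\ge 0}$; its size is $\sum_v C(v)$. A pebbling move removes two pebbles from a vertex and places one pebble on an adjacent vertex. A configuration is $r$-solvable if some sequence of pebbling moves places a pebble on $r$. $\pi(G,r)$ is the minimum $m$ such that every configuration of size $m$ is $r$-solvable, and $\pi(G)=\max_{r}\pi(G,r)$. The Two-Player Pebbling Game on $G$ with root $r$ and starting configuration $C$ is played by Mover and Defender in rounds: in each round Mover makes a pebbling move and then Defender makes a pebbling move; each player must take their turn. If Mover pebbles from $u$ to $v$, Defender may not pebble from $v$ to $u$ in the same round. Mover wins if at any time the root has at least one pebble; Defender wins if the root has no pebble and there are no more pebbling moves. A winning strategy is a rule choosing a player's moves as a function of the current position which guarantees that player wins. $\eta(G,r)$ is the minimum $m$ such that for every configuration of $m$ pebbles Mover has a winning strategy; if for arbitrarily large $m$ there is a configuration of size greater than $m$ on which Defender has a winning strategy, then $\eta(G,r)=\infty$. $\eta(G)=\max_r \eta(G,r)$. -}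

module Defs where

open import Data.Nat using (ℕ; zero; suc; _+_; _∸_; _≤_; _<_)
open import Data.Fin using (Fin)
open import Data.Fin.Properties using () renaming (_≟_ to _≟ᶠ_)
open import Data.List using (List; map)
open import Data.Nat.ListAction using (sum)
open import Data.List using () renaming (allFin to allFinL)
open import Data.Product using (Σ; _×_; _,_)
open import Data.Sum using (_⊎_)
open import Relation.Nullary using (¬_; yes; no)
open import Relation.Binary.PropositionalEquality using (_≡_)
open import Relation.Binary.Construct.Closure.ReflexiveTransitive using (Star)

record Graph (n : ℕ) : Set₁ where
  field
    Adj       : Fin n → Fin n → Set
    symmetric : ∀ {u v} → Adj u v → Adj v u
    irreflex  : ∀ {u} → ¬ Adj u u
    nonempty  : 1 ≤ n
    connected : ∀ u v → Star Adj u v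
open Graph public

Config : ℕ → Set
Config n = Fin n → ℕ

size : ∀ {n} → Config n → ℕ
size {n} C = sum (map C (allFinL n))

step : ∀ {n} → Config n → Fin n → Fin n → Config n
step C u v w with w ≟ᶠ u | w ≟ᶠ v
... | yes _ | _     = C w ∸ 2
... | no _  | yes _ = suc (C w)
... | no _  | no _  = C w

Legal : ∀ {n} → Graph n → Config n → Fin n → Fin n → Set
Legal G C u v = Adj G u v × 2 ≤ C u

data Reach {n} (G : Graph n) : Config n → Config n → Set where
  done : ∀ {C} → Reach G C C
  move : ∀ {C D} u v → Legal G C u v → Reach G (step C u v) D → Reach G C D

Solvable : ∀ {n} → Graph n → Fin n → Config n → Set
Solvable G r C = Σ (Config _) λ D → Reach G C D × 1 ≤ D r

PiRootIs : ∀ {n} → Graph n → Fin n → ℕ → Set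
PiRootIs G r m =
  (∀ C → size C ≡ m → Solvable G r C) ×
  (∀ k → k < m → ¬ (∀ C → size C ≡ k → Solvable G r C))

PiIs : ∀ {n} → Graph n → ℕ → Set
PiIs {n} G m =
  (∀ r → Σ ℕ λ k → PiRootIs G r k × k ≤ m) × Σ (Fin n) λ r → PiRootIs G r m

-- Two-player pebbling game (positions where the root is empty are
-- checked at every move).  A position is either "Mover to move" at C,
-- or "Defender to move" at C after Mover's move u → v (so v → u is
-- forbidden for Defender).

mutual
  data MoverWins {n} (G : Graph n) (r : Fin n) (C : Config n) : Set where
    rootHit : 1 ≤ C r → MoverWins G r C
    play    : ∀ u v → Legal G C u v → MoverWinsAfter G r (step C u v) u v
            → MoverWins G r C

  data MoverWinsAfter {n} (G : Graph n) (r : Fin n) (C : Config n)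
                      (u v : Fin n) : Set where
    rootHit : 1 ≤ C r → MoverWinsAfter G r C u v
    respond : (Σ (Fin n) λ x → Σ (Fin n) λ y →
                 Legal G C x y × ¬ (x ≡ v × y ≡ u))
            → (∀ x y → Legal G C x y → ¬ (x ≡ v × y ≡ u)
                 → MoverWins G r (step C x y))
            → MoverWinsAfter G r C u v

mutual
  data DefenderWins {n} (G : Graph n) (r : Fin n) (C : Config n) : Set where
    defend : C r ≡ 0
           → (∀ u v → Legal G C u v → DefenderWinsAfter G r (step C u v) u v)
           → DefenderWins G r C

  data DefenderWinsAfter {n} (G : Graph n) (r : Fin n) (C : Config n)
                         (u v : Fin n) : Set where
    stuck : C r ≡ 0
          → (∀ x y → Legal G C x y → x ≡ v × y ≡ u)
          → DefenderWinsAfter G r C u v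
    reply : C r ≡ 0
          → ∀ x y → Legal G C x y → ¬ (x ≡ v × y ≡ u)
          → DefenderWins G r (step C x y)
          → DefenderWinsAfter G r C u v

data ℕ∞ : Set where
  fin : ℕ → ℕ∞
  ∞   : ℕ∞

data _≤∞_ : ℕ∞ → ℕ∞ → Set where
  fin≤fin : ∀ {a b} → a ≤ b → fin a ≤∞ fin b
  _≤∞∞    : ∀ x → x ≤∞ ∞

EtaRootIs : ∀ {n} → Graph n → Fin n → ℕ∞ → Set
EtaRootIs G r ∞ =
  ∀ m → Σ (Config _) λ C → m < size C × DefenderWins G r C
EtaRootIs G r (fin m) =
  (∀ C → m ≤ size C → MoverWins G r C) ×
  (∀ k → k < m → ¬ (∀ C → k ≤ size C → MoverWins G r C))

EtaIs : ∀ {n} → Graph n → ℕ∞ → Set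
EtaIs {n} G e =
  (∀ r → Σ ℕ∞ λ k → EtaRootIs G r k × k ≤∞ e) × Σ (Fin n) λ r → EtaRootIs G r e

module Submission where

-- Both inequalities are proved root by root and then
-- transferred to the maxima: π(G) = π(G,r) for some root r, and
-- π(G,r) ≤ η(G,r) ≤ η(G).
--
-- A configuration with at most one pebble per vertex
-- ("sparse") admits no pebbling move, so if its root is empty it is not
-- solvable.  For every root r and every k < n there is a sparse
-- configuration of size k avoiding r; hence π(G,r) > k for all k < n.
--
-- A winning strategy for Mover, followed against any
-- Defender, is in particular a sequence of pebbling moves reaching the
-- root; so if Mover wins on every configuration of size at least k, then
-- every configuration of size k is solvable and π(G,r) ≤ k by minimality.

open import Defs
open import Data.Nat using (ℕ; _≤_)
open import Data.Product using (_×_)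

open import Data.Nat using (zero; suc; _<_; z≤n; s≤s; _≤?_)
open import Data.Nat.Properties using (≤-trans; ≤-reflexive; ≰⇒>; n≮0; 1+n≰n)
open import Data.Nat.ListAction using (sum)
open import Data.Fin using (Fin) renaming (zero to fzero; suc to fsuc)
open import Data.List using (tabulate)
open import Data.List.Properties using (map-tabulate)
open import Data.Vec.Functional using (_∷_)
open import Data.Product using (Σ-syntax; _,_)
open import Data.Empty using (⊥-elim)
open import Relation.Nullary using (¬_; yes; no)
open import Relation.Binary.PropositionalEquality using (_≡_; refl; sym; trans; cong; subst)

-- The size of a configuration as a sum over a tabulated list; this form
-- unfolds definitionally along  a ∷ C, which the constructions below use.
tsum : ∀ {n} → Config n → ℕ
tsum C = sum (tabulate C)

size-tsum : ∀ {n} (C : Config n) → size C ≡ tsum C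
size-tsum C = cong sum (map-tabulate (λ w → w) C)

Sparse : ∀ {n} → Config n → Set
Sparse C = ∀ w → C w ≤ 1

sparse-∷ : ∀ {n a} {C : Config n} → a ≤ 1 → Sparse C → Sparse (a ∷ C)
sparse-∷ a≤1 _      fzero    = a≤1
sparse-∷ _   sparse (fsuc w) = sparse w

sparse-stuck : ∀ {n} (G : Graph n) {C : Config n} {u v} → Sparse C → ¬ Legal G C u v
sparse-stuck G {u = u} sparse (_ , two) = 1+n≰n (≤-trans two (sparse u))

sparse-unsolvable : ∀ {n} (G : Graph n) r {C : Config n} →
  C r ≡ 0 → Sparse C → ¬ Solvable G r C
sparse-unsolvable G r empty _ (_ , done , hit) = n≮0 (subst (1 ≤_) empty hit)
sparse-unsolvable G r _ sparse (_ , move _ _ legal _ , _) = sparse-stuck G sparse legal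

sparse-of-size : ∀ n k → k ≤ n → Σ[ C ∈ Config n ] Sparse C × tsum C ≡ k
sparse-of-size zero    zero    z≤n = (λ ()) , (λ ()) , refl
sparse-of-size (suc n) zero    z≤n with sparse-of-size n zero z≤n
... | C , sparse , sz = 0 ∷ C , sparse-∷ z≤n sparse , sz
sparse-of-size (suc n) (suc k) (s≤s k≤n) with sparse-of-size n k k≤n
... | C , sparse , sz = 1 ∷ C , sparse-∷ (s≤s z≤n) sparse , cong suc sz

sparse-avoiding : ∀ {n} (r : Fin n) k → k < n →
  Σ[ C ∈ Config n ] C r ≡ 0 × Sparse C × tsum C ≡ k
sparse-avoiding {suc n} fzero k (s≤s k≤n) with sparse-of-size n k k≤n
... | C , sparse , sz = 0 ∷ C , refl , sparse-∷ z≤n sparse , sz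
sparse-avoiding {suc (suc n)} (fsuc r) zero _ with sparse-avoiding r zero (s≤s z≤n)
... | C , empty , sparse , sz = 0 ∷ C , empty , sparse-∷ z≤n sparse , sz
sparse-avoiding {suc n} (fsuc r) (suc k) (s≤s k<n) with sparse-avoiding r k k<n
... | C , empty , sparse , sz = 1 ∷ C , empty , sparse-∷ (s≤s z≤n) sparse , cong suc sz

-- Playing out Mover's winning strategy yields a pebbling sequence to the
-- root (Defender's replies are pebbling moves too).
mutual
  moverWins⇒solvable : ∀ {n} {G : Graph n} {r C} → MoverWins G r C → Solvable G r C
  moverWins⇒solvable {C = C} (rootHit hit) = C , done , hit
  moverWins⇒solvable (play u v legal after) with moverWinsAfter⇒solvable after
  ... | D , reach , hit = D , move u v legal reach , hit

  moverWinsAfter⇒solvable : ∀ {n} {G : Graph n} {r C u v} →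
    MoverWinsAfter G r C u v → Solvable G r C
  moverWinsAfter⇒solvable {C = C} (rootHit hit) = C , done , hit
  moverWinsAfter⇒solvable (respond (x , y , legal , allowed) continue)
    with moverWins⇒solvable (continue x y legal allowed)
  ... | D , reach , hit = D , move x y legal reach , hit

-- π(G,r) ≥ n: below n pebbles there is an unsolvable configuration.
piRoot-lower : ∀ {n} (G : Graph n) {r m} → PiRootIs G r m → n ≤ m
piRoot-lower {n} G {r} {m} (solves , _) with n ≤? m
... | yes n≤m = n≤m
... | no n≰m with sparse-avoiding r m (≰⇒> n≰m)
...   | C , empty , sparse , sz =
        ⊥-elim (sparse-unsolvable G r empty sparse (solves C (trans (size-tsum C) sz)))

piRoot-minimal : ∀ {n} (G : Graph n) {r m} k → PiRootIs G r m →
  (∀ C → size C ≡ k → Solvable G r C) → m ≤ k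
piRoot-minimal G {m = m} k (_ , least) solves with m ≤? k
... | yes m≤k = m≤k
... | no m≰k  = ⊥-elim (least k (≰⇒> m≰k) solves)

piRoot≤etaRoot : ∀ {n} (G : Graph n) {r m} e → PiRootIs G r m → EtaRootIs G r e →
  fin m ≤∞ e
piRoot≤etaRoot G ∞       _  _          = fin _ ≤∞∞
piRoot≤etaRoot G (fin k) πr (wins , _) =
  fin≤fin (piRoot-minimal G k πr
    (λ C sz → moverWins⇒solvable (wins C (≤-reflexive (sym sz)))))

≤∞-trans : ∀ {a b c} → a ≤∞ b → b ≤∞ c → a ≤∞ c
≤∞-trans (fin≤fin a≤b) (fin≤fin b≤c) = fin≤fin (≤-trans a≤b b≤c)
≤∞-trans {a} _         (_ ≤∞∞)       = a ≤∞∞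

proposition2p1 : ∀ {n} (G : Graph n) (m : ℕ) → PiIs G m →
    n ≤ m × (∀ e → EtaIs G e → fin m ≤∞ e)
proposition2p1 G m (_ , r , πr) = piRoot-lower G πr , eta-bound
  where
  eta-bound : ∀ e → EtaIs G e → fin m ≤∞ e
  eta-bound e (etaRoots , _) with etaRoots r
  ... | k , ηr , k≤e = ≤∞-trans (piRoot≤etaRoot G k πr ηr) k≤e
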